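{- Let $n$ be a composite positive integer, let $q$ be the smallest prime divisor of $n$ and $p$ the smallest prime divisor of $n/q$. Then the number of generalized wreath circulant digraphs of order $n$ is at most $(\log_2^2 n)\,2^{n/p+n/q-n/(pq)-1}$.
   Context: A circulant digraph of order $n$ is $\Gamma(\mathbb{Z}_n,S)$ with vertex set $\mathbb{Z}_n$, arc set $\{(u,v):u-v\in S\}$, $S\subseteq\mathbb{Z}_n\setminus\{0\}$, counted as labelled objects (by $S$). It is a generalized wreath circulant digraph if there are subgroups $\{0\}\ne K\le H\ne\mathbb{Z}_n$ of $\mathbb{Z}_n$ with $S\setminus H$ a union of cosets of $K$. $\log_2^2 n$ denotes $(\log_2 n)^2$. -}

module Defs where

open import Data.Nat using (ℕ; zero; suc; _+_; _*_; _∸_; _^_; _<_; _≤_; NonZero)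
open import Data.Nat.DivMod using (_%_; m%n<n)
open import Data.Nat.Divisibility using (_∣_)
open import Data.Nat.Primality using (Prime)
open import Data.Fin using (Fin; toℕ; fromℕ<)
open import Data.Fin.Subset using (Subset; _∈_; _∉_; _⊆_)
open import Data.List using (List; length)
open import Data.List.Relation.Unary.All using (All)
open import Data.List.Relation.Unary.Unique.Propositional using (Unique)
open import Data.Product using (Σ; ∃; _×_; _,_)
open import Relation.Binary.PropositionalEquality using (_≡_; _≢_)

module _ (n : ℕ) .{{_ : NonZero n}} where

  zeroₙ : Fin n
  zeroₙ = fromℕ< (m%n<n 0 n)

  _⊕_ : Fin n → Fin n → Fin n
  x ⊕ y = fromℕ< (m%n<n (toℕ x + toℕ y) n)

  ⊖_ : Fin n → Fin n
  ⊖ x = fromℕ< (m%n<n (n ∸ toℕ x) n)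

  record IsSubgroup (H : Subset n) : Set where
    field
      has-zero : zeroₙ ∈ H
      closed-+ : ∀ x y → x ∈ H → y ∈ H → (x ⊕ y) ∈ H
      closed-⊖ : ∀ x → x ∈ H → (⊖ x) ∈ H

  -- A connection set: S ⊆ ℤ_n ∖ {0}; the circulant digraph Γ(ℤ_n, S)
  -- is counted as the labelled object S.
  IsConnectionSet : Subset n → Set
  IsConnectionSet S = zeroₙ ∉ S

  UnionOfCosetsOutside : Subset n → Subset n → Subset n → Set
  UnionOfCosetsOutside S H K =
    ∀ x k → x ∉ H → x ∈ S → k ∈ K → (x ⊕ k) ∈ S

  IsGenWreath : Subset n → Set
  IsGenWreath S =
    Σ (Subset n) λ K → Σ (Subset n) λ H →
      IsSubgroup K × IsSubgroup H × K ⊆ H ×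
      (∃ λ k → k ∈ K × k ≢ zeroₙ) ×
      (∃ λ h → h ∉ H) ×
      UnionOfCosetsOutside S H K

  GenWreathFamily : List (Subset n) → Set
  GenWreathFamily l = Unique l × All (λ S → IsConnectionSet S × IsGenWreath S) l

SmallestPrimeDivisor : ℕ → ℕ → Set
SmallestPrimeDivisor q m = Prime q × q ∣ m × (∀ r → Prime r → r ∣ m → q ≤ r)

-- c ≤ (log₂ n)² · 2^e, expressed without reals:
-- for all a, b with b > 0 and (a/b)² < c / 2^e, we have a/b < log₂ n, i.e. 2^a < n^b.
AtMostLog²Times2^ : ℕ → ℕ → ℕ → Set
AtMostLog²Times2^ c n e =
  ∀ a b → 0 < b → a * a * 2 ^ e < c * (b * b) → 2 ^ a < n ^ b

-- Let S be a generalized wreath connection set, with subgroups K ≤ H. Choosing cb ∈ K generating a subgroup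
-- of prime index a (so n = a c b) and a prime b dividing the generator of H, S ∖ bℤ is invariant under
-- translation by cb.
-- Such an S is determined by which of the ac − 1 nonzero multiples of b and the c(b − 1) non-multiples of b
-- below cb lie in S. As q ≤ a, b and p ≤ max(a, b), antitonicity of (x + y − 1)/(xy) bounds this number of
-- positions by n/p + n/q − n/(pq) − 1. Recording additionally the positions of a and b in the prime
-- factorisation of n, whose length is at most log₂ n, encodes S injectively.
module Submission where

open import Defs
open import Data.Nat
open import Data.Nat.Properties
open import Data.Nat.DivMod
open import Data.Nat.Divisibility
open import Data.Nat.GCD
open import Data.Nat.Primality
open import Data.Nat.Primality.Factorisation
open import Data.Nat.ListAction using (product)
open import Data.Nat.Tactic.RingSolver using (solve-∀)
open import Data.Fin using (Fin; zero; suc; toℕ; combine; inject≤; funToFin; finToFun) renaming (_<_ to _<ᶠ_)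
open import Data.Fin.Properties
  using (toℕ-fromℕ<; toℕ<n; toℕ-injective; 2↔Bool; pigeonhole; combine-injective; inject≤-injective; finToFun-funToFin)
open import Data.Fin.Subset using (Subset; _∈_; _∉_; _⊆_)
open import Data.Fin.Subset.Properties using (_∈?_; ⊆-antisym)
open import Data.Vec using (lookup)
open import Data.Vec.Properties using ([]=⇒lookup; lookup⇒[]=)
open import Data.List using (List; []; _∷_; _++_; map; length; applyUpTo; upTo; cartesianProductWith)
import Data.List as List
open import Data.List.Properties using (length-++; length-map; length-applyUpTo; length-upTo)
open import Data.List.Relation.Unary.All as All using (All; []; _∷_)
open import Data.List.Relation.Unary.AllPairs using (_∷_)
open import Data.List.Relation.Unary.Any using (index)
open import Data.List.Relation.Unary.Any.Properties using (lookup-index)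
open import Data.List.Relation.Unary.Unique.Propositional using (Unique)
open import Data.List.Membership.Propositional using () renaming (_∈_ to _∈ᴸ_)
open import Data.List.Membership.Propositional.Properties
  using (∈-++⁺ˡ; ∈-++⁺ʳ; ∈-applyUpTo⁺; ∈-upTo⁺; ∈-cartesianProductWith⁺; ∈-lookup)
open import Data.List.Membership.Setoid.Properties using (index-injective)
open import Data.Product using (∃; ∃₂; _×_; _,_; proj₁; proj₂; map₂)
open import Data.Sum using (_⊎_; inj₁; inj₂; [_,_]′)
open import Function using (_∘_)
open import Function.Bundles using (Inverse)
open import Relation.Nullary using (¬_; yes; no; contradiction)
open import Relation.Unary using (Decidable)
open import Relation.Binary.PropositionalEquality

IsLeastPositive : (ℕ → Set) → ℕ → Set
IsLeastPositive P m = 0 < m × P m × (∀ {j} → 0 < j → j < m → ¬ P j)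

module _ {P : ℕ → Set} (P? : Decidable P) where

  none-or-least-positive : ∀ N → (∀ {j} → 0 < j → j ≤ N → ¬ P j) ⊎ ∃ (IsLeastPositive P)
  none-or-least-positive zero = inj₁ (λ 0<j j≤0 → contradiction (≤-trans 0<j j≤0) λ ())
  none-or-least-positive (suc N) with none-or-least-positive N
  ... | inj₂ least = inj₂ least
  ... | inj₁ none with P? (suc N)
  ...   | yes p = inj₂ (suc N , z<s , p , λ 0<j j<1+N → none 0<j (s≤s⁻¹ j<1+N))
  ...   | no ¬p = inj₁ λ {j} 0<j j≤1+N → [ (λ j<1+N → none 0<j (s≤s⁻¹ j<1+N)) , (λ { refl → ¬p }) ]′
                                          (m≤n⇒m<n∨m≡n j≤1+N)

  least-positive : ∀ {N} → 0 < N → P N → ∃ (IsLeastPositive P)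
  least-positive {N} 0<N pN with none-or-least-positive N
  ... | inj₁ none  = contradiction pN (none 0<N ≤-refl)
  ... | inj₂ least = least

∃-prime-divisor : ∀ {d} → 1 < d → ∃ λ a → Prime a × a ∣ d
∃-prime-divisor {d} 1<d with factorise d {{>-nonZero (<-trans z<s 1<d)}}
... | record { factors = [] ; isFactorisation = d≡1 } = contradiction d≡1 (>⇒≢ 1<d)
... | record { factors = a ∷ as ; isFactorisation = d≡a*as ; factorsPrime = a-prime ∷ _ } =
  a , a-prime , divides (product as) (trans d≡a*as (*-comm a (product as)))

r+iα+[a-1]iα≡r+i[aα] : ∀ a .{{_ : NonZero a}} r i α → r + i * α + pred a * i * α ≡ r + i * (a * α)
r+iα+[a-1]iα≡r+i[aα] (suc a) r i α = identity a r i α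
  where
  identity : ∀ a r i α → r + i * α + a * i * α ≡ r + i * (suc a * α)
  identity = solve-∀

length-cartesianProductWith : ∀ {A B C : Set} (f : A → B → C) xs ys →
                              length (cartesianProductWith f xs ys) ≡ length xs * length ys
length-cartesianProductWith f []       ys = refl
length-cartesianProductWith f (x ∷ xs) ys =
  trans (length-++ (map (f x) ys)) (cong₂ _+_ (length-map (f x) ys) (length-cartesianProductWith f xs ys))

positions : ℕ → ℕ → ℕ → List ℕ
positions a b c = applyUpTo (λ u → b * suc u) (a * c ∸ 1)
               ++ cartesianProductWith (λ i s → b * i + suc s) (upTo c) (upTo (b ∸ 1))

length-positions : ∀ a b c → length (positions a b c) ≡ a * c ∸ 1 + c * (b ∸ 1)
length-positions a b c = begin
  length (positions a b c)
    ≡⟨ length-++ (applyUpTo (λ u → b * suc u) (a * c ∸ 1)) ⟩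
  length (applyUpTo (λ u → b * suc u) (a * c ∸ 1))
    + length (cartesianProductWith (λ i s → b * i + suc s) (upTo c) (upTo (b ∸ 1)))
    ≡⟨ cong₂ _+_ (length-applyUpTo _ (a * c ∸ 1)) (length-cartesianProductWith _ (upTo c) (upTo (b ∸ 1))) ⟩
  a * c ∸ 1 + length (upTo c) * length (upTo (b ∸ 1))
    ≡⟨ cong₂ (λ u v → a * c ∸ 1 + u * v) (length-upTo c) (length-upTo (b ∸ 1)) ⟩
  a * c ∸ 1 + c * (b ∸ 1) ∎
  where open ≡-Reasoning

multiple∈positions : ∀ {a b c y} → 0 < y → y < a * (c * b) → b ∣ y → y ∈ᴸ positions a b c
multiple∈positions 0<y _ (divides zero refl) = contradiction 0<y λ ()
multiple∈positions {a} {b} {c} 0<y y<acb (divides (suc u) refl) =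
  subst (_∈ᴸ positions a b c) (*-comm b (suc u)) (∈-++⁺ˡ (∈-applyUpTo⁺ (λ u → b * suc u) u<ac∸1))
  where
  u<ac∸1 : u < a * c ∸ 1
  u<ac∸1 = ∸-monoˡ-< (*-cancelʳ-< b (suc u) (a * c) (subst (suc u * b <_) (sym (*-assoc a c b)) y<acb)) z<s

nonmultiple∈positions : ∀ {a b c r} .{{_ : NonZero b}} → r < c * b → ¬ b ∣ r → r ∈ᴸ positions a b c
nonmultiple∈positions {a} {b} {c} {r} r<cb b∤r with r % b in r%b≡
... | zero  = contradiction (m%n≡0⇒n∣m r b r%b≡) b∤r
... | suc s = subst (_∈ᴸ positions a b c) (sym r≡b*[r/b]+1+s)
  (∈-++⁺ʳ (applyUpTo (λ u → b * suc u) (a * c ∸ 1))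
          (∈-cartesianProductWith⁺ (λ i s → b * i + suc s) (∈-upTo⁺ r/b<c) (∈-upTo⁺ s<b∸1)))
  where
  r/b<c : r / b < c
  r/b<c = *-cancelʳ-< b (r / b) c (≤-<-trans (m/n*n≤m r b) r<cb)
  s<b∸1 : s < b ∸ 1
  s<b∸1 = ∸-monoˡ-< (subst (_< b) r%b≡ (m%n<n r b)) z<s
  r≡b*[r/b]+1+s : r ≡ b * (r / b) + suc s
  r≡b*[r/b]+1+s = begin
    r                 ≡⟨ m≡m%n+[m/n]*n r b ⟩
    r % b + r / b * b ≡⟨ cong (_+ r / b * b) r%b≡ ⟩
    suc s + r / b * b ≡⟨ +-comm (suc s) (r / b * b) ⟩
    r / b * b + suc s ≡⟨ cong (_+ suc s) (*-comm (r / b) b) ⟩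
    b * (r / b) + suc s ∎
    where open ≡-Reasoning

module _ {n : ℕ} .{{_ : NonZero n}} where

  _∈ₙ_ : ℕ → Subset n → Set
  y ∈ₙ S = y mod n ∈ S

  toℕ-mod : ∀ m → toℕ (m mod n) ≡ m % n
  toℕ-mod m = toℕ-fromℕ< (m%n<n m n)

  mod-cong : ∀ {m m′} → m % n ≡ m′ % n → m mod n ≡ m′ mod n
  mod-cong {m} {m′} eq = toℕ-injective (trans (toℕ-mod m) (trans eq (sym (toℕ-mod m′))))

  toℕ-zeroₙ : toℕ (zeroₙ n) ≡ 0
  toℕ-zeroₙ = trans (toℕ-mod 0) (m*n%n≡0 0 n)

  toℕ-mod-id : (x : Fin n) → toℕ x mod n ≡ x
  toℕ-mod-id x = toℕ-injective (trans (toℕ-mod (toℕ x)) (m<n⇒m%n≡m (toℕ<n x)))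

  ⊕-mod : ∀ a b → _⊕_ n (a mod n) (b mod n) ≡ (a + b) mod n
  ⊕-mod a b = mod-cong (trans (cong₂ (λ u v → (u + v) % n) (toℕ-mod a) (toℕ-mod b))
                              (sym (%-distribˡ-+ a b n)))

  ⊖-mod : ∀ a → ⊖_ n (a mod n) ≡ (n ∸ a % n) mod n
  ⊖-mod a = mod-cong (cong (λ u → (n ∸ u) % n) (toℕ-mod a))

  +*n-mod : ∀ m k → (m + k * n) mod n ≡ m mod n
  +*n-mod m k = mod-cong ([m+kn]%n≡m%n m k n)

  m+[n∸m%n]≡[1+m/n]*n : ∀ m → m + (n ∸ m % n) ≡ suc (m / n) * n
  m+[n∸m%n]≡[1+m/n]*n m = begin
    m + (n ∸ m % n)                 ≡⟨ cong (_+ (n ∸ m % n)) (m≡m%n+[m/n]*n m n) ⟩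
    m % n + m / n * n + (n ∸ m % n) ≡⟨ +-assoc (m % n) (m / n * n) (n ∸ m % n) ⟩
    m % n + (m / n * n + (n ∸ m % n)) ≡⟨ cong (m % n +_) (+-comm (m / n * n) (n ∸ m % n)) ⟩
    m % n + ((n ∸ m % n) + m / n * n) ≡⟨ +-assoc (m % n) (n ∸ m % n) (m / n * n) ⟨
    m % n + (n ∸ m % n) + m / n * n ≡⟨ cong (_+ m / n * n) (m+[n∸m]≡n (<⇒≤ (m%n<n m n))) ⟩
    n + m / n * n                   ∎
    where open ≡-Reasoning

  ≡-nonZero : ∀ {m} → n ≡ m → NonZero m
  ≡-nonZero n≡m = >-nonZero (subst (0 <_) n≡m (>-nonZero⁻¹ n))

  toℕ-∈ₙ : ∀ {x : Fin n} {S} → x ∈ S → toℕ x ∈ₙ S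
  toℕ-∈ₙ {x} {S} = subst (_∈ S) (sym (toℕ-mod-id x))

  ∈ₙ-toℕ : ∀ {x : Fin n} {S} → toℕ x ∈ₙ S → x ∈ S
  ∈ₙ-toℕ {x} {S} = subst (_∈ S) (toℕ-mod-id x)

  nonzero-divisor<n : ∀ {g} (k : Fin n) → k ≢ zeroₙ n → g ∣ toℕ k → g < n
  nonzero-divisor<n k k≢0 g∣k = ≤-<-trans (∣⇒≤ {{≢-nonZero toℕk≢0}} g∣k) (toℕ<n k)
    where
    toℕk≢0 : toℕ k ≢ 0
    toℕk≢0 k≡0 = k≢0 (toℕ-injective (trans k≡0 (sym toℕ-zeroₙ)))

  1<cofactor : ∀ {d g} → n ≡ d * g → g < n → 1 < d
  1<cofactor {0}           n≡0   _   = contradiction n≡0 (>⇒≢ (>-nonZero⁻¹ n))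
  1<cofactor {1}     {g}   n≡1*g g<n = contradiction (trans n≡1*g (+-identityʳ g)) (>⇒≢ g<n)
  1<cofactor {suc (suc _)} _     _   = s<s z<s

  module SubgroupProperties {G : Subset n} (G-subgroup : IsSubgroup n G) where
    open IsSubgroup G-subgroup

    n∈G : n ∈ₙ G
    n∈G = subst (_∈ G) (mod-cong (trans (m*n%n≡0 0 n) (sym (n%n≡0 n)))) has-zero

    +-closed : ∀ {a b} → a ∈ₙ G → b ∈ₙ G → (a + b) ∈ₙ G
    +-closed {a} {b} a∈G b∈G = subst (_∈ G) (⊕-mod a b) (closed-+ _ _ a∈G b∈G)

    *-closed : ∀ j {a} → a ∈ₙ G → (j * a) ∈ₙ G
    *-closed zero    a∈G = has-zero
    *-closed (suc j) a∈G = +-closed a∈G (*-closed j a∈G)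

    ∸-closed : ∀ {a b} → (a + b) ∈ₙ G → b ∈ₙ G → a ∈ₙ G
    ∸-closed {a} {b} a+b∈G b∈G = subst (_∈ G) a+b-b≡a
      (+-closed a+b∈G (subst (_∈ G) (⊖-mod b) (closed-⊖ _ b∈G)))
      where
      a+b-b≡a : (a + b + (n ∸ b % n)) mod n ≡ a mod n
      a+b-b≡a = trans (cong (_mod n) (trans (+-assoc a b _) (cong (a +_) (m+[n∸m%n]≡[1+m/n]*n b))))
                      (+*n-mod a (suc (b / n)))

    gcd-closed : ∀ {a b} → a ∈ₙ G → b ∈ₙ G → gcd a b ∈ₙ G
    gcd-closed {a} {b} a∈G b∈G with Bézout.identity (gcd-GCD a b)
    ... | Bézout.+- x y eq = ∸-closed (subst (_∈ₙ G) (sym eq) (*-closed x a∈G)) (*-closed y b∈G)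
    ... | Bézout.-+ x y eq = ∸-closed (subst (_∈ₙ G) (sym eq) (*-closed y b∈G)) (*-closed x a∈G)

    least-generator : ∃ λ g → 0 < g × g ∈ₙ G × (∀ y → y ∈ₙ G → g ∣ y)
    least-generator with least-positive (λ m → m mod n ∈? G) (>-nonZero⁻¹ n) n∈G
    ... | g , 0<g , g∈G , below-g = g , 0<g , g∈G , g∣
      where
      instance _ = >-nonZero 0<g
      -- gcd g y ∈ G is positive and at most g, so by minimality it equals g
      g∣ : ∀ y → y ∈ₙ G → g ∣ y
      g∣ zero    _   = divides 0 refl
      g∣ (suc y) y∈G with m≤n⇒m<n∨m≡n (∣⇒≤ (gcd[m,n]∣m g (suc y)))
      ... | inj₁ gcd<g = contradiction (gcd-closed g∈G y∈G)
                           (below-g (n≢0⇒n>0 (gcd[m,n]≢0 g (suc y) (inj₂ λ ()))) gcd<g)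
      ... | inj₂ gcd≡g = subst (_∣ suc y) gcd≡g (gcd[m,n]∣n g (suc y))

    nontrivial⇒∃prime-index-element : (∃ λ k → k ∈ G × k ≢ zeroₙ n) →
                                      ∃₂ λ a α → Prime a × n ≡ a * α × α ∈ₙ G
    nontrivial⇒∃prime-index-element (k , k∈G , k≢0)
      with g , _ , g∈G , g∣ ← least-generator
      with divides d n≡d*g ← g∣ n n∈G
      with a , a-prime , divides d′ d≡d′*a ←
             ∃-prime-divisor (1<cofactor {d} n≡d*g (nonzero-divisor<n k k≢0 (g∣ (toℕ k) (toℕ-∈ₙ k∈G))))
      = a , d′ * g , a-prime
      , trans n≡d*g (trans (cong (_* g) (trans d≡d′*a (*-comm d′ a))) (*-assoc a d′ g))
      , *-closed d′ g∈G

    proper⇒1∉ₙG : (∃ λ h → h ∉ G) → ¬ 1 ∈ₙ G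
    proper⇒1∉ₙG (h , h∉G) 1∈G =
      h∉G (subst (_∈ G) (toℕ-mod-id h) (subst (_∈ₙ G) (*-identityʳ (toℕ h)) (*-closed (toℕ h) 1∈G)))

    proper⇒∃prime-dividing-all : (∃ λ h → h ∉ G) → ∃ λ b → Prime b × (∀ y → y ∈ₙ G → b ∣ y)
    proper⇒∃prime-dividing-all proper
      with g , 0<g , g∈G , g∣ ← least-generator
      with b , b-prime , b∣g ← ∃-prime-divisor (≤∧≢⇒< 0<g λ { refl → proper⇒1∉ₙG proper g∈G })
      = b , b-prime , λ y y∈G → ∣-trans b∣g (g∣ y y∈G)

  ShiftClosedOff : ℕ → ℕ → Subset n → Set
  ShiftClosedOff b α S = ∀ y → ¬ b ∣ y → y ∈ₙ S → (y + α) ∈ₙ S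

  record WreathShape (S : Subset n) : Set where
    constructor shape
    field
      {a b c}      : ℕ
      a-prime      : Prime a
      b-prime      : Prime b
      n≡a*[c*b]    : n ≡ a * (c * b)
      shift-closed : ShiftClosedOff b (c * b) S

  genWreath⇒shape : ∀ {S} → IsGenWreath n S → WreathShape S
  genWreath⇒shape {S} (K , H , K-subgroup , H-subgroup , K⊆H , K-nontrivial , H-proper , cosets)
    with a , α , a-prime , n≡a*α , α∈K ← SubgroupProperties.nontrivial⇒∃prime-index-element K-subgroup K-nontrivial
    with b , b-prime , b∣H ← SubgroupProperties.proper⇒∃prime-dividing-all H-subgroup H-proper
    with divides c refl ← b∣H α (K⊆H α∈K)
    = shape {c = c} a-prime b-prime n≡a*α λ y b∤y y∈S →
        subst (_∈ S) (⊕-mod y α) (cosets (y mod n) (α mod n) (b∤y ∘ b∣H y) y∈S α∈K)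

  module Periodicity {b α S} (b∣α : b ∣ α) (closed : ShiftClosedOff b α S) where

    ∤-% : .{{_ : NonZero α}} → ∀ {y} → ¬ b ∣ y → ¬ b ∣ y % α
    ∤-% {y} b∤y b∣y%α = b∤y (subst (b ∣_) (sym (m≡m%n+[m/n]*n y α)) (∣m∣n⇒∣m+n b∣y%α (∣n⇒∣m*n (y / α) b∣α)))

    ∤-shift : ∀ {y} k → ¬ b ∣ y → ¬ b ∣ (y + k * α)
    ∤-shift {y} k b∤y b∣y+kα = b∤y (∣m+n∣m⇒∣n (subst (b ∣_) (+-comm y (k * α)) b∣y+kα) (∣n⇒∣m*n k b∣α))

    shift-closed-* : ∀ j {y} → ¬ b ∣ y → y ∈ₙ S → (y + j * α) ∈ₙ S
    shift-closed-* zero    {y} _   y∈S = subst (_∈ₙ S) (sym (+-identityʳ y)) y∈S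
    shift-closed-* (suc j) {y} b∤y y∈S =
      subst (_∈ₙ S) (trans (+-assoc y (j * α) α) (cong (y +_) (+-comm (j * α) α)))
            (closed (y + j * α) (∤-shift j b∤y) (shift-closed-* j b∤y y∈S))

    module _ {a} .{{_ : NonZero a}} .{{_ : NonZero α}} (n≡a*α : n ≡ a * α) where

      %-closed : ∀ {y} → ¬ b ∣ y → y ∈ₙ S → (y % α) ∈ₙ S
      %-closed {y} b∤y y∈S = subst (_∈ S) y+[a-1][y/α]α≡y%α (shift-closed-* (pred a * (y / α)) b∤y y∈S)
        where
        y+[a-1][y/α]α≡y%α : (y + pred a * (y / α) * α) mod n ≡ (y % α) mod n
        y+[a-1][y/α]α≡y%α = begin
          (y + pred a * (y / α) * α) mod n
            ≡⟨ cong (λ u → (u + pred a * (y / α) * α) mod n) (m≡m%n+[m/n]*n y α) ⟩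
          (y % α + y / α * α + pred a * (y / α) * α) mod n
            ≡⟨ cong (_mod n) (r+iα+[a-1]iα≡r+i[aα] a (y % α) (y / α) α) ⟩
          (y % α + y / α * (a * α)) mod n
            ≡⟨ cong (λ u → (y % α + y / α * u) mod n) n≡a*α ⟨
          (y % α + y / α * n) mod n
            ≡⟨ +*n-mod (y % α) (y / α) ⟩
          (y % α) mod n ∎
          where open ≡-Reasoning

      %-closed⁻¹ : ∀ {y} → ¬ b ∣ y → (y % α) ∈ₙ S → y ∈ₙ S
      %-closed⁻¹ {y} b∤y y%α∈S = subst (_∈ₙ S) (sym (m≡m%n+[m/n]*n y α))
        (shift-closed-* (y / α) (∤-% b∤y) y%α∈S)

  shift-closed-⊆ : ∀ {a b c S S′} → Prime b → n ≡ a * (c * b) → zeroₙ n ∉ S →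
                   ShiftClosedOff b (c * b) S → ShiftClosedOff b (c * b) S′ →
                   (∀ {y} → y ∈ᴸ positions a b c → y ∈ₙ S → y ∈ₙ S′) → S ⊆ S′
  shift-closed-⊆ {a} {b} {c} {S} {S′} b-prime n≡a*cb 0∉S closed closed′ agree {x} x∈S
    with b ∣? toℕ x
  ... | yes b∣x =
    ∈ₙ-toℕ (agree (multiple∈positions {a} {b} {c} 0<x (subst (toℕ x <_) n≡a*cb (toℕ<n x)) b∣x) (toℕ-∈ₙ x∈S))
    where
    0<x : 0 < toℕ x
    0<x = n≢0⇒n>0 λ x≡0 → 0∉S (subst (_∈ S) (toℕ-injective (trans x≡0 (sym toℕ-zeroₙ))) x∈S)
  ... | no b∤x = ∈ₙ-toℕ (P′.%-closed⁻¹ {a} n≡a*cb b∤x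
                   (agree (nonmultiple∈positions {a} {b} {c} (m%n<n (toℕ x) (c * b)) (P.∤-% b∤x))
                          (P.%-closed {a} n≡a*cb b∤x (toℕ-∈ₙ x∈S))))
    where
    instance
      b≢0 : NonZero b
      b≢0 = prime⇒nonZero b-prime
      cb≢0 : NonZero (c * b)
      cb≢0 = m*n≢0⇒n≢0 a {{≡-nonZero n≡a*cb}}
      a≢0 : NonZero a
      a≢0 = m*n≢0⇒m≢0 a {{≡-nonZero n≡a*cb}}
    module P  = Periodicity {b} {c * b} {S} (n∣m*n c) closed
    module P′ = Periodicity {b} {c * b} {S′} (n∣m*n c) closed′

-- (x + y − 1)/(xy) = 1 − (1 − 1/x)(1 − 1/y) decreases in x and in y.
[x+y∸1]*[p*q]≤[p+q∸1]*[x*y] : ∀ {p q x y} → 0 < p → 0 < q → p ≤ x → q ≤ y →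
                              (x + y ∸ 1) * (p * q) ≤ (p + q ∸ 1) * (x * y)
[x+y∸1]*[p*q]≤[p+q∸1]*[x*y] {suc p} {suc q} _ _ p≤x q≤y
  with s , refl ← m≤n⇒∃[o]m+o≡n p≤x
  with t , refl ← m≤n⇒∃[o]m+o≡n q≤y
  = ≤-trans (m≤m+n _ _) (≤-reflexive (sym (identity p q s t)))
  where
  identity : ∀ p q s t → (p + suc q) * ((suc p + s) * (suc q + t))
                       ≡ (p + s + (suc q + t)) * (suc p * suc q) + (suc p * t * p + s * suc q * q + (p + suc q) * s * t)
  identity = solve-∀

a*c∸1+c*[b∸1]≡[a+b∸1]*c∸1 : ∀ {a b c} → 0 < a → 0 < b → 0 < c →
                             a * c ∸ 1 + c * (b ∸ 1) ≡ (a + b ∸ 1) * c ∸ 1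
a*c∸1+c*[b∸1]≡[a+b∸1]*c∸1 {suc a} {suc b} {suc c} _ _ _ = cong (_∸ 1) (identity a b c)
  where
  identity : ∀ a b c → suc (c + a * suc c + suc c * b) ≡ (a + suc b) * suc c
  identity = solve-∀

n≡a*[c*b]⇒a∣n : ∀ a c b {n} → n ≡ a * (c * b) → a ∣ n
n≡a*[c*b]⇒a∣n a c b n≡a*cb = subst (_ ∣_) (sym n≡a*cb) (m∣m*n (c * b))

n≡a*[c*b]⇒b∣n : ∀ a c b {n} → n ≡ a * (c * b) → b ∣ n
n≡a*[c*b]⇒b∣n a c b n≡a*cb = subst (_ ∣_) (sym n≡a*cb) (∣n⇒∣m*n a (n∣m*n c))

prime⇒>0 : ∀ {x} → Prime x → 0 < x
prime⇒>0 {x} x-prime = >-nonZero⁻¹ x {{prime⇒nonZero x-prime}}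

prime∣prime⇒≡ : ∀ {a q} → Prime a → Prime q → a ∣ q → a ≡ q
prime∣prime⇒≡ a-prime q-prime a∣q with prime⇒irreducible q-prime a∣q
... | inj₁ refl = contradiction a-prime λ ()
... | inj₂ a≡q  = a≡q

module _ {n q m p r : ℕ} .{{_ : NonZero n}} (q-smallest : SmallestPrimeDivisor q n) (n≡q*m : n ≡ q * m)
         (p-smallest : SmallestPrimeDivisor p m) (m≡p*r : m ≡ p * r) where

  p≰⇒≡q : ∀ {x} → Prime x → x ∣ n → ¬ p ≤ x → x ≡ q
  p≰⇒≡q {x} x-prime x∣n p≰x with euclidsLemma q m x-prime (subst (x ∣_) n≡q*m x∣n)
  ... | inj₁ x∣q = prime∣prime⇒≡ x-prime (proj₁ q-smallest) x∣q
  ... | inj₂ x∣m = contradiction (proj₂ (proj₂ p-smallest) x x-prime x∣m) p≰x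

  p≤a⊎p≤b : ∀ {a b c} → Prime a → Prime b → n ≡ a * (c * b) → p ≤ a ⊎ p ≤ b
  p≤a⊎p≤b {a} {b} {c} a-prime b-prime n≡a*cb with p ≤? a | p ≤? b
  ... | yes p≤a | _       = inj₁ p≤a
  ... | no _    | yes p≤b = inj₂ p≤b
  ... | no p≰a  | no p≰b
    with refl ← p≰⇒≡q a-prime (n≡a*[c*b]⇒a∣n a c b n≡a*cb) p≰a
    with refl ← p≰⇒≡q b-prime (n≡a*[c*b]⇒b∣n a c b n≡a*cb) p≰b
    = contradiction (proj₂ (proj₂ p-smallest) a a-prime (divides c m≡c*a)) p≰a
    where
    m≡c*a : m ≡ c * a
    m≡c*a = *-cancelˡ-≡ m (c * a) a {{prime⇒nonZero a-prime}} (trans (sym n≡q*m) n≡a*cb)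

  cofactor-bound : ∀ {a b c} → Prime a → Prime b → n ≡ a * (c * b) → (a + b ∸ 1) * c ≤ (q + p ∸ 1) * r
  cofactor-bound {a} {b} {c} a-prime b-prime n≡a*cb = *-cancelʳ-≤ _ _ n (begin
    (a + b ∸ 1) * c * n             ≡⟨ cong ((a + b ∸ 1) * c *_) (trans n≡q*m (cong (q *_) m≡p*r)) ⟩
    (a + b ∸ 1) * c * (q * (p * r)) ≡⟨ regroupˡ (a + b ∸ 1) c q p r ⟩
    (a + b ∸ 1) * (q * p) * (c * r) ≤⟨ *-monoˡ-≤ (c * r) key ⟩
    (q + p ∸ 1) * (a * b) * (c * r) ≡⟨ regroupʳ (q + p ∸ 1) r a c b ⟩
    (q + p ∸ 1) * r * (a * (c * b)) ≡⟨ cong ((q + p ∸ 1) * r *_) n≡a*cb ⟨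
    (q + p ∸ 1) * r * n             ∎)
    where
    open ≤-Reasoning
    regroupˡ : ∀ x c q p r → x * c * (q * (p * r)) ≡ x * (q * p) * (c * r)
    regroupˡ = solve-∀
    regroupʳ : ∀ y r a c b → y * (a * b) * (c * r) ≡ y * r * (a * (c * b))
    regroupʳ = solve-∀
    q≤ : ∀ {x} → Prime x → x ∣ n → q ≤ x
    q≤ {x} = proj₂ (proj₂ q-smallest) x
    0<q : 0 < q
    0<q = prime⇒>0 (proj₁ q-smallest)
    0<p : 0 < p
    0<p = prime⇒>0 (proj₁ p-smallest)
    key : (a + b ∸ 1) * (q * p) ≤ (q + p ∸ 1) * (a * b)
    key with p≤a⊎p≤b {c = c} a-prime b-prime n≡a*cb
    ... | inj₁ p≤a = subst₂ (λ u v → (u ∸ 1) * (q * p) ≤ (q + p ∸ 1) * v) (+-comm b a) (*-comm b a)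
                       ([x+y∸1]*[p*q]≤[p+q∸1]*[x*y] 0<q 0<p (q≤ b-prime (n≡a*[c*b]⇒b∣n a c b n≡a*cb)) p≤a)
    ... | inj₂ p≤b = [x+y∸1]*[p*q]≤[p+q∸1]*[x*y] 0<q 0<p (q≤ a-prime (n≡a*[c*b]⇒a∣n a c b n≡a*cb)) p≤b

  positions-bound : ∀ {a b c} → Prime a → Prime b → n ≡ a * (c * b) →
                    a * c ∸ 1 + c * (b ∸ 1) ≤ q * r + p * r ∸ r ∸ 1
  positions-bound {a} {b} {c} a-prime b-prime n≡a*cb = begin
    a * c ∸ 1 + c * (b ∸ 1)   ≡⟨ a*c∸1+c*[b∸1]≡[a+b∸1]*c∸1 (prime⇒>0 a-prime) (prime⇒>0 b-prime) 0<c ⟩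
    (a + b ∸ 1) * c ∸ 1       ≤⟨ ∸-monoˡ-≤ 1 (cofactor-bound a-prime b-prime n≡a*cb) ⟩
    (q + p ∸ 1) * r ∸ 1       ≡⟨ cong (_∸ 1) (trans (*-distribʳ-∸ r (q + p) 1) (cong₂ _∸_ (*-distribʳ-+ r q p) (*-identityˡ r))) ⟩
    q * r + p * r ∸ r ∸ 1     ∎
    where
    open ≤-Reasoning
    0<c : 0 < c
    0<c = n≢0⇒n>0 λ { refl → contradiction (trans n≡a*cb (*-zeroʳ a)) (>⇒≢ (>-nonZero⁻¹ n)) }

lookup-injective : ∀ {A : Set} {xs : List A} → Unique xs → ∀ {i j} → i <ᶠ j → List.lookup xs i ≢ List.lookup xs j
lookup-injective (x∉xs ∷ _)  {zero}  {suc j} _       = All.lookup x∉xs (∈-lookup j)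
lookup-injective (_ ∷ xs!)   {suc i} {suc j} (s≤s i<j) = lookup-injective xs! i<j

module _ {A : Set} {P : A → Set} {N : ℕ} (code : ∀ x → P x → Fin N)
         (code-injective : ∀ {x y} px py → code x px ≡ code y py → x ≡ y) where

  length≤-of-injective-code : ∀ {xs} → Unique xs → All P xs → length xs ≤ N
  length≤-of-injective-code {xs} xs! pxs with length xs ≤? N
  ... | yes xs≤N = xs≤N
  ... | no  xs≰N with i , j , i<j , codes≡ ← pigeonhole (≰⇒> xs≰N) (λ i → code (List.lookup xs i) (All.lookup pxs (∈-lookup i)))
    = contradiction (code-injective _ _ codes≡) (lookup-injective xs! i<j)

2^length≤product : ∀ {xs} → All Prime xs → 2 ^ length xs ≤ product xs
2^length≤product []                = ≤-refl
2^length≤product (x-prime ∷ primes) = *-mono-≤ (nonTrivial⇒n>1 _ {{prime⇒nonTrivial x-prime}}) (2^length≤product primes)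

AtMostLog²Times2^-intro : ∀ {k N} w e → 2 ^ w ≤ N → k ≤ w * w * 2 ^ e → AtMostLog²Times2^ k N e
AtMostLog²Times2^-intro {k} {N} w e 2^w≤N k≤w²2^e a b _ a²2^e<kb² = begin-strict
  2 ^ a       <⟨ ^-monoʳ-< 2 (s≤s (s≤s z≤n)) a<wb ⟩
  2 ^ (w * b) ≡⟨ ^-*-assoc 2 w b ⟨
  (2 ^ w) ^ b ≤⟨ ^-monoˡ-≤ b 2^w≤N ⟩
  N ^ b       ∎
  where
  open ≤-Reasoning
  regroup : ∀ w b E → w * w * E * (b * b) ≡ (w * b) * (w * b) * E
  regroup = solve-∀
  a²<[wb]² : a * a < (w * b) * (w * b)
  a²<[wb]² = *-cancelʳ-< (2 ^ e) (a * a) ((w * b) * (w * b))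
    (<-≤-trans a²2^e<kb² (≤-trans (*-monoˡ-≤ (b * b) k≤w²2^e) (≤-reflexive (regroup w b (2 ^ e)))))
  a<wb : a < w * b
  a<wb with a <? w * b
  ... | yes a<wb = a<wb
  ... | no  a≮wb = contradiction a²<[wb]² (≤⇒≯ (*-mono-≤ (≮⇒≥ a≮wb) (≮⇒≥ a≮wb)))

module _ {n : ℕ} .{{_ : NonZero n}} where

  profile : Subset n → (xs : List ℕ) → Fin (2 ^ length xs)
  profile S xs = funToFin λ i → Inverse.from 2↔Bool (lookup S (List.lookup xs i mod n))

  profile-agree : ∀ {S S′} xs → profile S xs ≡ profile S′ xs → ∀ {y} → y ∈ᴸ xs → y ∈ₙ S → y ∈ₙ S′
  profile-agree {S} {S′} xs profiles≡ {y} y∈xs y∈S =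
    lookup⇒[]= _ S′ (trans (sym (subst (λ x → lookup S (x mod n) ≡ lookup S′ (x mod n)) (sym y≡xᵢ) lookups≡))
                           ([]=⇒lookup y∈S))
    where
    open Inverse 2↔Bool using (to; from; strictlyInverseˡ)
    bit : Subset n → Fin (length xs) → Fin 2
    bit T i = from (lookup T (List.lookup xs i mod n))
    i : Fin (length xs)
    i = index y∈xs
    y≡xᵢ : y ≡ List.lookup xs i
    y≡xᵢ = lookup-index y∈xs
    bits≡ : bit S i ≡ bit S′ i
    bits≡ = trans (sym (finToFun-funToFin (bit S) i))
                  (trans (cong (λ k → finToFun k i) profiles≡) (finToFun-funToFin (bit S′) i))
    lookups≡ : lookup S (List.lookup xs i mod n) ≡ lookup S′ (List.lookup xs i mod n)
    lookups≡ = trans (sym (strictlyInverseˡ _)) (trans (cong to bits≡) (strictlyInverseˡ _))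

  profile-determines : ∀ {a b c S S′} → Prime b → n ≡ a * (c * b) → zeroₙ n ∉ S → zeroₙ n ∉ S′ →
                       ShiftClosedOff b (c * b) S → ShiftClosedOff b (c * b) S′ →
                       profile S (positions a b c) ≡ profile S′ (positions a b c) → S ≡ S′
  profile-determines {a} {b} {c} b-prime n≡a*cb 0∉S 0∉S′ closed closed′ profiles≡ =
    ⊆-antisym (shift-closed-⊆ {a = a} {b} {c} b-prime n≡a*cb 0∉S closed closed′ (profile-agree (positions a b c) profiles≡))
              (shift-closed-⊆ {a = a} {b} {c} b-prime n≡a*cb 0∉S′ closed′ closed (profile-agree (positions a b c) (sym profiles≡)))

  module Encoding (e : ℕ)
                  (bound : ∀ {a b c} → Prime a → Prime b → n ≡ a * (c * b) → a * c ∸ 1 + c * (b ∸ 1) ≤ e) where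

    open PrimeFactorisation (factorise n) using (isFactorisation; factorsPrime)

    primes : List ℕ
    primes = factors (factorise n)

    2^|primes|≤n : 2 ^ length primes ≤ n
    2^|primes|≤n = subst (2 ^ length primes ≤_) (sym isFactorisation) (2^length≤product factorsPrime)

    prime∈primes : ∀ {a} → Prime a → a ∣ n → a ∈ᴸ primes
    prime∈primes a-prime a∣n =
      factorisationHasAllPrimeFactors a-prime (subst (_ ∣_) isFactorisation a∣n) factorsPrime

    prime-index : ∀ {a} → Prime a → a ∣ n → Fin (length primes)
    prime-index a-prime a∣n = index (prime∈primes a-prime a∣n)

    prime-index-injective : ∀ {a a′} (a-prime : Prime a) (a′-prime : Prime a′) a∣n a′∣n →
                            prime-index a-prime a∣n ≡ prime-index a′-prime a′∣n → a ≡ a′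
    prime-index-injective a-prime a′-prime a∣n a′∣n =
      index-injective (setoid ℕ) (prime∈primes a-prime a∣n) (prime∈primes a′-prime a′∣n)

    Coded : Subset n → Set
    Coded S = IsConnectionSet n S × WreathShape S

    code : ∀ S → Coded S → Fin (length primes * length primes * 2 ^ e)
    code S (_ , shape {a} {b} {c} a-prime b-prime n≡a*cb _) =
      combine (combine (prime-index a-prime (n≡a*[c*b]⇒a∣n a c b n≡a*cb))
                       (prime-index b-prime (n≡a*[c*b]⇒b∣n a c b n≡a*cb)))
              (inject≤ (profile S (positions a b c)) (^-monoʳ-≤ 2 |positions|≤e))
      where
      |positions|≤e : length (positions a b c) ≤ e
      |positions|≤e = subst (_≤ e) (sym (length-positions a b c)) (bound a-prime b-prime n≡a*cb)

    code-injective : ∀ {S S′} σ σ′ → code S σ ≡ code S′ σ′ → S ≡ S′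
    code-injective {S} {S′} (0∉S , shape {c = c} a-prime b-prime n≡a*cb closed)
                            (0∉S′ , shape {a′} {b′} {c′} a′-prime b′-prime n≡a′*c′b′ closed′) codes≡
      with ij≡ , profiles≡ ← combine-injective _ _ _ _ codes≡
      with i≡ , j≡ ← combine-injective _ _ _ _ ij≡
      with refl ← prime-index-injective a-prime a′-prime _ _ i≡
      with refl ← prime-index-injective b-prime b′-prime _ _ j≡
      with refl ← *-cancelʳ-≡ c c′ b′ {{prime⇒nonZero b′-prime}}
                    (*-cancelˡ-≡ _ _ a′ {{prime⇒nonZero a′-prime}} (trans (sym n≡a*cb) n≡a′*c′b′))
      = profile-determines {a = a′} {b′} {c} b-prime n≡a*cb 0∉S 0∉S′ closed closed′ (inject≤-injective _ _ _ _ profiles≡)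

corollary2p13 : (n : ℕ) .{{_ : NonZero n}} → Composite n →
    (q m p r : ℕ) →
    SmallestPrimeDivisor q n → n ≡ q * m →
    SmallestPrimeDivisor p m → m ≡ p * r →
    (l : List (Subset n)) → GenWreathFamily n l →
    AtMostLog²Times2^ (length l) n (q * r + p * r ∸ r ∸ 1)
-- Compositeness of n is only needed for q, m, p, r to exist.
corollary2p13 n _ q m p r q-smallest n≡q*m p-smallest m≡p*r l (l-unique , l-wreaths) =
  AtMostLog²Times2^-intro (length primes) e 2^|primes|≤n
    (length≤-of-injective-code code code-injective l-unique (All.map (map₂ genWreath⇒shape) l-wreaths))
  where
  e : ℕ
  e = q * r + p * r ∸ r ∸ 1
  open Encoding e (positions-bound q-smallest n≡q*m p-smallest m≡p*r)
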